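{- Let $\tau\ge 2$ and $e\ge 1$ be integers. Put $$N=2^{e+\tau-1}-(2^e+1)3^{\tau-1},\qquad D=2^{e+\tau-1}-3^{\tau},$$ and assume $D<0$ and $N/D<\min(3^\tau,2^{e+\tau-1})$. Since $D$ is coprime to $2$ and to $3$, let $\rho_3$ be the unique integer in $\{0,\dots,3^\tau-1\}$ with $\rho_3D\equiv N\pmod{3^\tau}$, and let $\rho_2$ be the unique integer in $\{0,\dots,2^{e+\tau-1}-1\}$ with $\rho_2D\equiv N\pmod{2^{e+\tau-1}}$. Then the following hold. - If $\tau$ is even: $\rho_3=2\cdot 3^{\tau-1}+1$ and $\rho_2=\frac{2^e(2^{\tau}+1)+1}{3}$ when $e$ is even; $\rho_3=1$ and $\rho_2=\frac{2^e+1}{3}$ when $e$ is odd. - If $\tau$ is odd: $\rho_3=3^{\tau-1}+1$ and $\rho_2=\frac{2^e(2^{\tau-1}+1)+1}{3}$ when $e$ is even; $\rho_3=1$ and $\rho_2=\frac{2^e+1}{3}$ when $e$ is odd.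
   Context: The number $N/D$ is the maximal element of a hypothetical cycle of the accelerated $3x-1$ map $x\mapsto (3x-1)/2^{v_2(3x-1)}$ on odd integers, having $\tau$ elements and exponent sequence $(1,\dots,1,e)$. -}

module Defs where

open import Data.Nat as ℕ using (ℕ; _∸_; _^_; _<_)
open import Data.Integer as ℤ using (ℤ; +_; _-_; _*_)
open import Data.Integer.Divisibility as ℤd using ()

Nval : ℕ → ℕ → ℤ
Nval e τ = + (2 ^ (e ℕ.+ τ ∸ 1)) - (+ (2 ^ e ℕ.+ 1) * + (3 ^ (τ ∸ 1)))

Dval : ℕ → ℕ → ℤ
Dval e τ = + (2 ^ (e ℕ.+ τ ∸ 1)) - + (3 ^ τ)

IsResidue : ℕ → ℤ → ℤ → ℕ → Set
IsResidue m D N ρ = ρ < m × (+ m) ℤd.∣ (+ ρ * D - N)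
  where open import Data.Product using (_×_)

{-# OPTIONS --safe #-}
-- Write P = 2^(e+τ-1) and T = 3^(τ-1), so that D = P - 3T and N = P - (2^e+1)T.
-- Modulo 3T we have D ≡ P and modulo P we have D ≡ -3T; both are units, so each residue is unique.
-- Since 3 ∤ P there is k ∈ {0,1,2} with 3 ∣ kP + 2^e + 1; put V = (kP + 2^e + 1)/3.
-- Then (kT+1)D - N = q·3T and V·D - N = q·P with the same q = V - 1 - kT, so ρ₃ = kT+1 and ρ₂ = V.
-- As 2^n ≡ (-1)^n (mod 3), k = 0 for odd e, and k = 2 resp. 1 for even e and even resp. odd τ.

module Submission where

open import Defs
open import Data.Nat as ℕ using (ℕ; zero; suc; _∸_; _^_; _≥_; _/_; _≤_; z≤n; s≤s)
import Data.Nat.Properties as ℕP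
open import Data.Nat.Divisibility
  using (_∣_; _∤_; _∣?_; divides; ∣-refl; ∣-trans; _∣0; ∣1⇒≡1; ∣⇒≤; ∣m∣n⇒∣m+n; ∣m+n∣m⇒∣n)
open import Data.Nat.DivMod using (m*n/n≡m)
open import Data.Nat.Coprimality as Cop using (Coprime; coprime-divisor)
open import Data.Nat.Tactic.RingSolver using () renaming (solve-∀ to ℕ-solve)
open import Data.Integer as ℤ using (ℤ; +_; _*_; _<_; _⊓_; _-_; -_; ∣_∣; 0ℤ; 1ℤ; -1ℤ)
import Data.Integer.Properties as ℤP
import Data.Integer.Coprimality as ℤCop
open import Data.Integer.Divisibility.Signed as ℤS using (∣ᵤ⇒∣; ∣⇒∣ᵤ)
open import Data.Integer.Tactic.RingSolver using () renaming (solve-∀ to ℤ-solve)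
open import Data.Product using (_×_; _,_; ∃-syntax; map₁)
open import Relation.Nullary using (¬_; yes; no; contradiction)
open import Relation.Nullary.Decidable using (from-yes)
open import Relation.Binary.PropositionalEquality

∣∧<⇒≡0 : ∀ {m n} → m ∣ n → n ℕ.< m → n ≡ 0
∣∧<⇒≡0 {n = zero}  _   _   = refl
∣∧<⇒≡0 {n = suc _} m∣n n<m = contradiction (∣⇒≤ m∣n) (ℕP.<⇒≱ n<m)

residue-unique : ∀ {m D N c ρ ρ′} → ℤCop.Coprime (+ m) c → (+ m) ℤS.∣ (D - c) →
                 IsResidue m D N ρ → IsResidue m D N ρ′ → ρ ≡ ρ′
residue-unique {m} {D} {N} {c} {ρ} {ρ′} m⊥c m∣D-c (ρ<m , m∣ρD-N) (ρ′<m , m∣ρ′D-N) =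
  ℤP.+-injective (ℤP.i-j≡0⇒i≡j (+ ρ) (+ ρ′) (ℤP.∣i∣≡0⇒i≡0 (∣∧<⇒≡0 m∣δ δ<m)))
  where
  δ : ℤ
  δ = + ρ - + ρ′

  rearrange : ∀ (a b c D N : ℤ) → c * (a - b) ≡ ((a * D - N) - (b * D - N)) - (a - b) * (D - c)
  rearrange = ℤ-solve

  m∣cδ : (+ m) ℤS.∣ (c * δ)
  m∣cδ = subst ((+ m) ℤS.∣_) (sym (rearrange (+ ρ) (+ ρ′) c D N))
    (ℤS.∣m∣n⇒∣m-n
      (ℤS.∣m∣n⇒∣m-n (∣ᵤ⇒∣ {i = + ρ * D - N} m∣ρD-N) (∣ᵤ⇒∣ {i = + ρ′ * D - N} m∣ρ′D-N))
      (ℤS.∣n⇒∣m*n δ m∣D-c))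

  m∣δ : m ∣ ∣ δ ∣
  m∣δ = ℤCop.coprime-divisor (+ m) c δ m⊥c (∣⇒∣ᵤ m∣cδ)

  δ<m : ∣ δ ∣ ℕ.< m
  δ<m = ℕP.≤-<-trans
    (subst (ℕ._≤ ρ ℕ.⊔ ρ′) (cong ∣_∣ (sym (ℤP.[+m]-[+n]≡m⊖n ρ ρ′))) (ℤP.∣m⊝n∣≤m⊔n ρ ρ′))
    (ℕP.⊔-lub ρ<m ρ′<m)

coprime-^ʳ : ∀ {a b} n → Coprime a b → Coprime a (b ^ n)
coprime-^ʳ         zero    _   (_ , i∣1)      = ∣1⇒≡1 i∣1
coprime-^ʳ {a} {b} (suc n) a⊥b {i} (i∣a , i∣b*bⁿ) =
  coprime-^ʳ n a⊥b (i∣a , coprime-divisor i⊥b i∣b*bⁿ)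
  where
  i⊥b : Coprime i b
  i⊥b (j∣i , j∣b) = a⊥b (∣-trans j∣i i∣a , j∣b)

coprime-^ : ∀ {a b} m n → Coprime a b → Coprime (a ^ m) (b ^ n)
coprime-^ m n a⊥b = Cop.sym (coprime-^ʳ m (Cop.sym (coprime-^ʳ n a⊥b)))

k*T+1<3*T : ∀ {k T} → k ≤ 2 → 2 ≤ T → k ℕ.* T ℕ.+ 1 ℕ.< 3 ℕ.* T
k*T+1<3*T {k} {T} k≤2 T≥2 = begin-strict
  k ℕ.* T ℕ.+ 1 ≤⟨ ℕP.+-monoˡ-≤ 1 (ℕP.*-monoˡ-≤ T k≤2) ⟩
  2 ℕ.* T ℕ.+ 1 ≡⟨ ℕP.+-comm (2 ℕ.* T) 1 ⟩
  1 ℕ.+ 2 ℕ.* T <⟨ ℕP.+-monoˡ-< (2 ℕ.* T) T≥2 ⟩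
  3 ℕ.* T       ∎
  where open ℕP.≤-Reasoning

k*P+[E+1]≡V*3⇒V<P : ∀ {k P E V} → k ≤ 2 → E ℕ.+ 1 ℕ.< P → k ℕ.* P ℕ.+ (E ℕ.+ 1) ≡ V ℕ.* 3 → V ℕ.< P
k*P+[E+1]≡V*3⇒V<P {k} {P} {E} {V} k≤2 E+1<P numerator = ℕP.*-cancelʳ-< 3 V P (begin-strict
  V ℕ.* 3               ≡⟨ numerator ⟨
  k ℕ.* P ℕ.+ (E ℕ.+ 1) ≤⟨ ℕP.+-monoˡ-≤ (E ℕ.+ 1) (ℕP.*-monoˡ-≤ P k≤2) ⟩
  2 ℕ.* P ℕ.+ (E ℕ.+ 1) <⟨ ℕP.+-monoʳ-< (2 ℕ.* P) E+1<P ⟩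
  2 ℕ.* P ℕ.+ P         ≡⟨ ℕP.+-comm (2 ℕ.* P) P ⟩
  3 ℕ.* P               ≡⟨ ℕP.*-comm 3 P ⟩
  P ℕ.* 3               ∎)
  where open ℕP.≤-Reasoning

drop-vanishing : ∀ {a b s : ℤ} t → s ≡ 0ℤ → a ≡ b ℤ.+ t * s → a ≡ b
drop-vanishing {a} {b} t refl a≡b+t*0 =
  trans a≡b+t*0 (trans (cong (λ z → b ℤ.+ z) (ℤP.*-zeroʳ t)) (ℤP.+-identityʳ b))

module CycleResidues {P T E : ℕ}
  (3T⊥P : Coprime (3 ℕ.* T) P) (T≥2 : 2 ≤ T) (E+1<P : E ℕ.+ 1 ℕ.< P) where

  D N : ℤ
  D = + P - + (3 ℕ.* T)
  N = + P - + (E ℕ.+ 1) * + T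

  private
    quotient₃-identity : ∀ (k P T W V : ℤ) →
      (k * T ℤ.+ 1ℤ) * (P - + 3 * T) - (P - W * T)
        ≡ (V - 1ℤ - k * T) * (+ 3 * T) ℤ.+ T * (k * P ℤ.+ W - V * + 3)
    quotient₃-identity = ℤ-solve

    quotientₚ-identity : ∀ (k P T W V : ℤ) →
      V * (P - + 3 * T) - (P - W * T)
        ≡ (V - 1ℤ - k * T) * P ℤ.+ T * (k * P ℤ.+ W - V * + 3)
    quotientₚ-identity = ℤ-solve

    D≡P : (+ (3 ℕ.* T)) ℤS.∣ (D - + P)
    D≡P = ℤS.divides -1ℤ (identity (+ P) (+ (3 ℕ.* T)))
      where
      identity : ∀ (P Q : ℤ) → (P - Q) - P ≡ -1ℤ * Q
      identity = ℤ-solve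

    D≡-3T : (+ P) ℤS.∣ (D - - + (3 ℕ.* T))
    D≡-3T = ℤS.divides 1ℤ (identity (+ P) (+ (3 ℕ.* T)))
      where
      identity : ∀ (P Q : ℤ) → (P - Q) - - Q ≡ 1ℤ * P
      identity = ℤ-solve

    P⊥-3T : ℤCop.Coprime (+ P) (- + (3 ℕ.* T))
    P⊥-3T = subst (Coprime P) (sym (ℤP.∣-i∣≡∣i∣ (+ (3 ℕ.* T)))) (Cop.sym 3T⊥P)

  residues : ∀ {ρ₃ ρ₂} k X → k ≤ 2 → k ℕ.* P ℕ.+ (E ℕ.+ 1) ≡ X → 3 ∣ X →
             IsResidue (3 ℕ.* T) D N ρ₃ → IsResidue P D N ρ₂ →
             ρ₃ ≡ k ℕ.* T ℕ.+ 1 × ρ₂ ≡ X / 3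
  residues k _ k≤2 numerator (divides V refl) R₃ R₂ =
    residue-unique 3T⊥P D≡P R₃ (k*T+1<3*T k≤2 T≥2 , ∣⇒∣ᵤ (ℤS.divides q quotient₃)) ,
    trans (residue-unique P⊥-3T D≡-3T R₂
             (k*P+[E+1]≡V*3⇒V<P k≤2 E+1<P numerator , ∣⇒∣ᵤ (ℤS.divides q quotientₚ)))
          (sym (m*n/n≡m V 3))
    where
    open ≡-Reasoning

    q : ℤ
    q = + V - 1ℤ - + k * + T

    slack≡0 : + k * + P ℤ.+ + (E ℕ.+ 1) - + V * + 3 ≡ 0ℤ
    slack≡0 = ℤP.i≡j⇒i-j≡0 (begin
      + k * + P ℤ.+ + (E ℕ.+ 1)   ≡⟨ cong (ℤ._+ + (E ℕ.+ 1)) (ℤP.pos-* k P) ⟨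
      + (k ℕ.* P) ℤ.+ + (E ℕ.+ 1) ≡⟨ ℤP.pos-+ (k ℕ.* P) (E ℕ.+ 1) ⟨
      + (k ℕ.* P ℕ.+ (E ℕ.+ 1))   ≡⟨ cong +_ numerator ⟩
      + (V ℕ.* 3)                 ≡⟨ ℤP.pos-* V 3 ⟩
      + V * + 3                   ∎)

    quotient₃ : + (k ℕ.* T ℕ.+ 1) * D - N ≡ q * + (3 ℕ.* T)
    quotient₃ = begin
      + (k ℕ.* T ℕ.+ 1) * D - N
        ≡⟨ cong₂ (λ r Q → r * (+ P - Q) - N)
                 (trans (ℤP.pos-+ (k ℕ.* T) 1) (cong (ℤ._+ 1ℤ) (ℤP.pos-* k T))) (ℤP.pos-* 3 T) ⟩
      (+ k * + T ℤ.+ 1ℤ) * (+ P - + 3 * + T) - N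
        ≡⟨ drop-vanishing (+ T) slack≡0 (quotient₃-identity (+ k) (+ P) (+ T) (+ (E ℕ.+ 1)) (+ V)) ⟩
      q * (+ 3 * + T)
        ≡⟨ cong (q *_) (ℤP.pos-* 3 T) ⟨
      q * + (3 ℕ.* T) ∎

    quotientₚ : + V * D - N ≡ q * + P
    quotientₚ = begin
      + V * D - N
        ≡⟨ cong (λ Q → + V * (+ P - Q) - N) (ℤP.pos-* 3 T) ⟩
      + V * (+ P - + 3 * + T) - N
        ≡⟨ drop-vanishing (+ T) slack≡0 (quotientₚ-identity (+ k) (+ P) (+ T) (+ (E ℕ.+ 1)) (+ V)) ⟩
      q * + P ∎

2^e+1<2^[e+t] : ∀ {e t} → e ≥ 1 → t ≥ 1 → 2 ^ e ℕ.+ 1 ℕ.< 2 ^ (e ℕ.+ t)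
2^e+1<2^[e+t] {e} {suc t} e≥1 (s≤s z≤n) = begin-strict
  2 ^ e ℕ.+ 1       <⟨ ℕP.+-monoʳ-< (2 ^ e) (ℕP.^-monoʳ-≤ 2 e≥1) ⟩
  2 ^ e ℕ.+ 2 ^ e   ≡⟨ cong (2 ^ e ℕ.+_) (ℕP.+-identityʳ (2 ^ e)) ⟨
  2 ^ suc e         ≤⟨ ℕP.^-monoʳ-≤ 2 (s≤s (ℕP.m≤m+n e t)) ⟩
  2 ^ suc (e ℕ.+ t) ≡⟨ cong (2 ^_) (ℕP.+-suc e t) ⟨
  2 ^ (e ℕ.+ suc t) ∎
  where open ℕP.≤-Reasoning

cycle-residues : ∀ {e t ρ₃ ρ₂} → e ≥ 1 → t ≥ 1 →
  IsResidue (3 ^ suc t) (Dval e (suc t)) (Nval e (suc t)) ρ₃ →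
  IsResidue (2 ^ (e ℕ.+ suc t ∸ 1)) (Dval e (suc t)) (Nval e (suc t)) ρ₂ →
  ∀ k X → k ≤ 2 → k ℕ.* (2 ^ e ℕ.* 2 ^ t) ℕ.+ (2 ^ e ℕ.+ 1) ≡ X → 3 ∣ X →
  ρ₃ ≡ k ℕ.* 3 ^ t ℕ.+ 1 × ρ₂ ≡ X / 3
cycle-residues {e} {t} e≥1 t≥1 R₃ R₂ k X k≤2 numerator 3∣X =
  CycleResidues.residues (coprime-^ (suc t) (e ℕ.+ suc t ∸ 1) 3⊥2) 3^t≥2 E+1<P
    k X k≤2 (trans (cong (λ P → k ℕ.* P ℕ.+ (2 ^ e ℕ.+ 1)) P≡E*F) numerator) 3∣X R₃ R₂
  where
  3⊥2 : Coprime 3 2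
  3⊥2 = from-yes (Cop.coprime? 3 2)

  3^t≥2 : 2 ≤ 3 ^ t
  3^t≥2 = ℕP.≤-trans (s≤s (s≤s z≤n)) (ℕP.^-monoʳ-≤ 3 t≥1)

  P≡2^[e+t] : 2 ^ (e ℕ.+ suc t ∸ 1) ≡ 2 ^ (e ℕ.+ t)
  P≡2^[e+t] = cong (λ n → 2 ^ (n ∸ 1)) (ℕP.+-suc e t)

  P≡E*F : 2 ^ (e ℕ.+ suc t ∸ 1) ≡ 2 ^ e ℕ.* 2 ^ t
  P≡E*F = trans P≡2^[e+t] (ℕP.^-distribˡ-+-* 2 e t)

  E+1<P : 2 ^ e ℕ.+ 1 ℕ.< 2 ^ (e ℕ.+ suc t ∸ 1)
  E+1<P = subst (2 ^ e ℕ.+ 1 ℕ.<_) (sym P≡2^[e+t]) (2^e+1<2^[e+t] e≥1 t≥1)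

2∤1 : 2 ∤ 1
2∤1 (divides zero    ())
2∤1 (divides (suc _) ())

2∣1+n⇒2∤n : ∀ {n} → 2 ∣ suc n → 2 ∤ n
2∣1+n⇒2∤n {n} 2∣1+n 2∣n = 2∤1 (∣m+n∣m⇒∣n (subst (2 ∣_) (ℕP.+-comm 1 n) 2∣1+n) 2∣n)

2∤n⇒2∣1+n : ∀ {n} → 2 ∤ n → 2 ∣ suc n
2∤n⇒2∣1+n {zero}        2∤0   = contradiction (2 ∣0) 2∤0
2∤n⇒2∣1+n {suc zero}    _     = ∣-refl
2∤n⇒2∣1+n {suc (suc n)} 2∤2+n =
  ∣m∣n⇒∣m+n (∣-refl {2}) (2∤n⇒2∣1+n (λ 2∣n → 2∤2+n (∣m∣n⇒∣m+n (∣-refl {2}) 2∣n)))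

2∤1+n⇒2∣n : ∀ {n} → 2 ∤ suc n → 2 ∣ n
2∤1+n⇒2∣n {n} 2∤1+n with 2 ∣? n
... | yes 2∣n = 2∣n
... | no  2∤n = contradiction (2∤n⇒2∣1+n 2∤n) 2∤1+n

2^even : ∀ {n} → 2 ∣ n → ∃[ c ] 2 ^ n ≡ 1 ℕ.+ 3 ℕ.* c
2^odd  : ∀ {n} → 2 ∤ n → ∃[ c ] 2 ^ n ≡ 2 ℕ.+ 3 ℕ.* c

2^even {zero}  _     = 0 , refl
2^even {suc n} 2∣1+n =
  let c , 2ⁿ≡ = 2^odd (2∣1+n⇒2∤n 2∣1+n) in 1 ℕ.+ 2 ℕ.* c , trans (cong (2 ℕ.*_) 2ⁿ≡) (double c)
  where
  double : ∀ c → 2 ℕ.* (2 ℕ.+ 3 ℕ.* c) ≡ 1 ℕ.+ 3 ℕ.* (1 ℕ.+ 2 ℕ.* c)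
  double = ℕ-solve

2^odd {zero}  2∤0   = contradiction (2 ∣0) 2∤0
2^odd {suc n} 2∤1+n =
  let c , 2ⁿ≡ = 2^even (2∤1+n⇒2∣n 2∤1+n) in 2 ℕ.* c , trans (cong (2 ℕ.*_) 2ⁿ≡) (double c)
  where
  double : ∀ c → 2 ℕ.* (1 ℕ.+ 3 ℕ.* c) ≡ 2 ℕ.+ 3 ℕ.* (2 ℕ.* c)
  double = ℕ-solve

3∣x+1 : ∀ {x} → ∃[ c ] x ≡ 2 ℕ.+ 3 ℕ.* c → 3 ∣ x ℕ.+ 1
3∣x+1 (c , refl) = divides (1 ℕ.+ c) (identity c)
  where
  identity : ∀ c → 2 ℕ.+ 3 ℕ.* c ℕ.+ 1 ≡ (1 ℕ.+ c) ℕ.* 3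
  identity = ℕ-solve

3∣x[y+1]+1 : ∀ {x y} → ∃[ c ] x ≡ 1 ℕ.+ 3 ℕ.* c → ∃[ d ] y ≡ 1 ℕ.+ 3 ℕ.* d →
             3 ∣ x ℕ.* (y ℕ.+ 1) ℕ.+ 1
3∣x[y+1]+1 (c , refl) (d , refl) = divides (1 ℕ.+ d ℕ.+ 2 ℕ.* c ℕ.+ 3 ℕ.* c ℕ.* d) (identity c d)
  where
  identity : ∀ c d → (1 ℕ.+ 3 ℕ.* c) ℕ.* (1 ℕ.+ 3 ℕ.* d ℕ.+ 1) ℕ.+ 1
                   ≡ (1 ℕ.+ d ℕ.+ 2 ℕ.* c ℕ.+ 3 ℕ.* c ℕ.* d) ℕ.* 3
  identity = ℕ-solve

3∣x[2y+1]+1 : ∀ {x y} → ∃[ c ] x ≡ 1 ℕ.+ 3 ℕ.* c → ∃[ d ] y ≡ 2 ℕ.+ 3 ℕ.* d →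
              3 ∣ x ℕ.* (2 ℕ.* y ℕ.+ 1) ℕ.+ 1
3∣x[2y+1]+1 (c , refl) (d , refl) = divides (2 ℕ.+ 2 ℕ.* d ℕ.+ 5 ℕ.* c ℕ.+ 6 ℕ.* c ℕ.* d) (identity c d)
  where
  identity : ∀ c d → (1 ℕ.+ 3 ℕ.* c) ℕ.* (2 ℕ.* (2 ℕ.+ 3 ℕ.* d) ℕ.+ 1) ℕ.+ 1
                   ≡ (2 ℕ.+ 2 ℕ.* d ℕ.+ 5 ℕ.* c ℕ.+ 6 ℕ.* c ℕ.* d) ℕ.* 3
  identity = ℕ-solve

k*[x*y]+[x+1]≡x*[k*y+1]+1 : ∀ k x y → k ℕ.* (x ℕ.* y) ℕ.+ (x ℕ.+ 1) ≡ x ℕ.* (k ℕ.* y ℕ.+ 1) ℕ.+ 1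
k*[x*y]+[x+1]≡x*[k*y+1]+1 = ℕ-solve

-- The hypotheses D < 0 and N/D < min(3^τ, 2^(e+τ-1)) only make N/D a cycle maximum; the residues do not need them.
mainTheorem6 : (τ e : ℕ) → τ ≥ 2 → e ≥ 1 →
    Dval e τ < + 0 →
    (+ (3 ^ τ) ⊓ + (2 ^ (e ℕ.+ τ ∸ 1))) * Dval e τ < Nval e τ →
    (ρ₃ ρ₂ : ℕ) →
    IsResidue (3 ^ τ) (Dval e τ) (Nval e τ) ρ₃ →
    IsResidue (2 ^ (e ℕ.+ τ ∸ 1)) (Dval e τ) (Nval e τ) ρ₂ →
    (2 ∣ τ → 2 ∣ e →
      ρ₃ ≡ 2 ℕ.* 3 ^ (τ ∸ 1) ℕ.+ 1 × ρ₂ ≡ (2 ^ e ℕ.* (2 ^ τ ℕ.+ 1) ℕ.+ 1) / 3)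
    × (2 ∣ τ → ¬ 2 ∣ e →
      ρ₃ ≡ 1 × ρ₂ ≡ (2 ^ e ℕ.+ 1) / 3)
    × (¬ 2 ∣ τ → 2 ∣ e →
      ρ₃ ≡ 3 ^ (τ ∸ 1) ℕ.+ 1 × ρ₂ ≡ (2 ^ e ℕ.* (2 ^ (τ ∸ 1) ℕ.+ 1) ℕ.+ 1) / 3)
    × (¬ 2 ∣ τ → ¬ 2 ∣ e →
      ρ₃ ≡ 1 × ρ₂ ≡ (2 ^ e ℕ.+ 1) / 3)
mainTheorem6 zero    _ ()
mainTheorem6 (suc t) e (s≤s t≥1) e≥1 _ _ ρ₃ ρ₂ R₃ R₂ =
  (λ 2∣τ 2∣e → even-e-odd-t 2∣e (2∣1+n⇒2∤n 2∣τ)) ,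
  (λ _ 2∤e → odd-e 2∤e) ,
  (λ 2∤τ 2∣e → even-e-even-t 2∣e (2∤1+n⇒2∣n 2∤τ)) ,
  (λ _ 2∤e → odd-e 2∤e)
  where
  E F : ℕ
  E = 2 ^ e
  F = 2 ^ t

  residues : ∀ k X → k ≤ 2 → k ℕ.* (E ℕ.* F) ℕ.+ (E ℕ.+ 1) ≡ X → 3 ∣ X →
             ρ₃ ≡ k ℕ.* 3 ^ t ℕ.+ 1 × ρ₂ ≡ X / 3
  residues = cycle-residues e≥1 t≥1 R₃ R₂

  odd-e : 2 ∤ e → ρ₃ ≡ 1 × ρ₂ ≡ (E ℕ.+ 1) / 3
  odd-e 2∤e = residues 0 (E ℕ.+ 1) z≤n refl (3∣x+1 (2^odd 2∤e))

  even-e-odd-t : 2 ∣ e → 2 ∤ t → ρ₃ ≡ 2 ℕ.* 3 ^ t ℕ.+ 1 × ρ₂ ≡ (E ℕ.* (2 ℕ.* F ℕ.+ 1) ℕ.+ 1) / 3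
  even-e-odd-t 2∣e 2∤t = residues 2 _ ℕP.≤-refl (k*[x*y]+[x+1]≡x*[k*y+1]+1 2 E F)
                           (3∣x[2y+1]+1 (2^even 2∣e) (2^odd 2∤t))

  even-e-even-t : 2 ∣ e → 2 ∣ t → ρ₃ ≡ 3 ^ t ℕ.+ 1 × ρ₂ ≡ (E ℕ.* (F ℕ.+ 1) ℕ.+ 1) / 3
  even-e-even-t 2∣e 2∣t =
    map₁ (λ ρ₃≡ → trans ρ₃≡ (cong (ℕ._+ 1) (ℕP.*-identityˡ (3 ^ t))))
      (residues 1 _ (s≤s z≤n)
        (trans (k*[x*y]+[x+1]≡x*[k*y+1]+1 1 E F) (cong (λ y → E ℕ.* (y ℕ.+ 1) ℕ.+ 1) (ℕP.*-identityˡ F)))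
        (3∣x[y+1]+1 (2^even 2∣e) (2^even 2∣t)))
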